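{- Let $G$ be a graph and let $(A,B,C)$ be a triple of bi-joins of $G$. Then there is a $2$-flip $G'$ of $G$ such that in $G'$ there is no edge whose two ends lie in two distinct sets among $A$, $B$, $C$.
   Context: All graphs are finite, simple. An ordered bipartition of $V(G)$ is a pair $(V_1,V_2)$ of nonempty disjoint sets with union $V(G)$. It is a bi-join of $G$ if there exist $W_1\subseteq V_1$, $W_2\subseteq V_2$ such that $W_1$ is complete to $W_2$ and anti-complete to $V_2\setminus W_2$, and $V_1\setminus W_1$ is complete to $V_2\setminus W_2$ and anti-complete to $W_2$ ($X$ complete/anti-complete to $Y$: every/no vertex of $X$ is adjacent to every vertex of $Y$). A partition $(A,B,C)$ of $V(G)$ is a triple of bi-joins if $(A,B\cup C)$, $(B,A\cup C)$ and $(C,A\cup B)$ are bi-joins of $G$. For $X,Y\subseteq V(G)$, $G\oplus(X,Y)$ is the graph on $V(G)$ in which the adjacency of distinct $u,v$ is toggled exactly when $(u,v)\in(X\times Y)\cup(Y\times X)$; $G\oplus\mathcal{S}$ applies all flips in $\mathcal{S}$. A $2$-flip of $G$ is a graph $G\oplus\mathcal{S}$ where, for some partition $\mathcal{P}$ of $V(G)$ with $|\mathcal{P}|\le2$, every pair in $\mathcal{S}$ is $(X,Y)$ with $X,Y\in\mathcal{P}$. -}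

module Defs where

open import Data.Nat using (ℕ; _≤_)
open import Data.Fin using (Fin)
open import Data.Bool using (Bool; true; false; _∧_; _∨_; _xor_; not)
open import Data.List using (List; foldr)
open import Data.List.Relation.Unary.Unique.Propositional using (Unique)
open import Data.Product using (Σ; _×_; _,_; ∃)
open import Data.Sum using (_⊎_)
open import Relation.Binary.PropositionalEquality using (_≡_; _≢_)

record Graph : Set where
  field
    n     : ℕ
    adj   : Fin n → Fin n → Bool
    sym   : ∀ u v → adj u v ≡ adj v u
    irrefl : ∀ u → adj u u ≡ false
open Graph public

VSet : ℕ → Set
VSet n = Fin n → Bool

_∈ₛ_ : ∀ {n} → Fin n → VSet n → Set
v ∈ₛ X = X v ≡ true

_∪ₛ_ : ∀ {n} → VSet n → VSet n → VSet n
(X ∪ₛ Y) v = X v ∨ Y v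

_∖ₛ_ : ∀ {n} → VSet n → VSet n → VSet n
(X ∖ₛ Y) v = X v ∧ not (Y v)

_⊆ₛ_ : ∀ {n} → VSet n → VSet n → Set
X ⊆ₛ Y = ∀ v → v ∈ₛ X → v ∈ₛ Y

Nonempty : ∀ {n} → VSet n → Set
Nonempty X = ∃ λ v → v ∈ₛ X

Complete : (G : Graph) → VSet (n G) → VSet (n G) → Set
Complete G X Y = ∀ x y → x ∈ₛ X → y ∈ₛ Y → adj G x y ≡ true

AntiComplete : (G : Graph) → VSet (n G) → VSet (n G) → Set
AntiComplete G X Y = ∀ x y → x ∈ₛ X → y ∈ₛ Y → adj G x y ≡ false

Bipartition : (G : Graph) → VSet (n G) → VSet (n G) → Set
Bipartition G V₁ V₂ =
  Nonempty V₁ × Nonempty V₂ ×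
  (∀ v → v ∈ₛ V₁ → v ∈ₛ V₂ → Data.Empty.⊥) ×
  (∀ v → v ∈ₛ (V₁ ∪ₛ V₂))
  where import Data.Empty

BiJoin : (G : Graph) → VSet (n G) → VSet (n G) → Set
BiJoin G V₁ V₂ =
  Bipartition G V₁ V₂ ×
  Σ (VSet (n G)) λ W₁ → Σ (VSet (n G)) λ W₂ →
    W₁ ⊆ₛ V₁ × W₂ ⊆ₛ V₂ ×
    Complete G W₁ W₂ × AntiComplete G W₁ (V₂ ∖ₛ W₂) ×
    Complete G (V₁ ∖ₛ W₁) (V₂ ∖ₛ W₂) × AntiComplete G (V₁ ∖ₛ W₁) W₂

Partition3 : ∀ {n} → VSet n → VSet n → VSet n → Set
Partition3 {n} A B C = ∀ (v : Fin n) →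
  (A v ≡ true × B v ≡ false × C v ≡ false) ⊎′
  (B v ≡ true × A v ≡ false × C v ≡ false) ⊎′
  (C v ≡ true × A v ≡ false × B v ≡ false)
  where
  open import Data.Sum using () renaming (_⊎_ to _⊎′_)

TripleOfBiJoins : (G : Graph) → VSet (n G) → VSet (n G) → VSet (n G) → Set
TripleOfBiJoins G A B C =
  Partition3 A B C ×
  BiJoin G A (B ∪ₛ C) × BiJoin G B (A ∪ₛ C) × BiJoin G C (A ∪ₛ B)

flipInd : ∀ {n} → VSet n → VSet n → Fin n → Fin n → Bool
flipInd X Y u v = (X u ∧ Y v) ∨ (Y u ∧ X v)

flipsAdj : (G : Graph) → List (VSet (n G) × VSet (n G)) → Fin (n G) → Fin (n G) → Bool
flipsAdj G S u v =
  foldr (λ { (X , Y) b → b xor flipInd X Y u v }) (adj G u v) S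

record VPartition (m : ℕ) (k : ℕ) : Set where
  field
    part     : Fin k → VSet m
    nonempty : ∀ i → Nonempty (part i)
    unique   : ∀ v → Σ (Fin k) λ i → v ∈ₛ part i × (∀ j → v ∈ₛ part j → j ≡ i)
open VPartition public

partFlips : ∀ {m k} → VPartition m k → List (Fin k × Fin k) → List (VSet m × VSet m)
partFlips P S = Data.List.map (λ { (i , j) → part P i , part P j }) S
  where import Data.List

-- The adjacency of a 2-flip G ⊕ S of G: a partition P of V(G) with |P| = k ≤ 2
-- and a set S (duplicate-free list) of pairs of parts of P.
record TwoFlipData (G : Graph) : Set where
  field
    k     : ℕ
    k≤2   : k ≤ 2
    P     : VPartition (n G) k
    S     : List (Fin k × Fin k)
    S-set : Unique S
open TwoFlipData public

twoFlipAdj : (G : Graph) → TwoFlipData G → Fin (n G) → Fin (n G) → Bool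
twoFlipAdj G D = flipsAdj G (partFlips (P D) (S D))

NoEdgeBetween : ∀ {m} → (Fin m → Fin m → Bool) → VSet m → VSet m → Set
NoEdgeBetween a X Y = ∀ u v → u ∈ₛ X → v ∈ₛ Y → a u v ≡ false

-- Across a bi-join (V₁ , V₂) the adjacency is affine over 𝔽₂: with the sets W₁, W₂ of the
-- definition, x ∈ V₁ and y ∈ V₂ are adjacent iff [x ∈ W₁] = [y ∈ W₂]. Fixing a₀ ∈ A, b₀ ∈ B,
-- c₀ ∈ C, the three bi-joins glue these descriptions into a single labelling ℓ : V(G) → 𝔽₂ and a
-- constant c with u ~ v ⟺ ℓ u + ℓ v + c = 1 for all u, v in different parts; c is the parity of
-- the triangle a₀ b₀ c₀. Flipping, in the partition {ℓ = 1, ℓ = 0} (one part if ℓ is constant),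
-- the pairs with ℓ u + ℓ v + c = 1 (the pair of parts if c = 0, each part with itself if c = 1)
-- removes exactly the edges between different parts.
{-# OPTIONS --safe #-}
module Submission where

open import Defs
open import Data.Bool using (Bool; true; false; not; _∧_; _∨_; _xor_; if_then_else_; _≟_)
open import Data.Bool.Properties
  using (xor-∧-commutativeRing; xor-same; xor-assoc; xor-identityʳ; ∨-zeroʳ; ¬-not)
open import Data.Empty using (⊥; ⊥-elim)
open import Data.Fin using (Fin; zero; suc)
open import Data.Fin.Properties using (any?)
open import Data.List using ([]; _∷_)
open import Data.List.Relation.Unary.All using ([]; _∷_)
open import Data.List.Relation.Unary.AllPairs using ([]; _∷_)
open import Data.Maybe using (Maybe; just; nothing)
open import Data.Nat using (s≤s; z≤n)
open import Data.Product using (Σ; ∃; _×_; _,_; proj₁; proj₂)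
open import Relation.Nullary using (yes; no)
open import Relation.Binary.PropositionalEquality as ≡ using (_≡_; refl; cong; cong₂)
open ≡.≡-Reasoning
open import Tactic.RingSolver.Core.AlmostCommutativeRing using (fromCommutativeRing)

false≟_ : ∀ x → Maybe (false ≡ x)
false≟ false = just refl
false≟ true  = nothing

-- Coefficients live in Bool itself, so the normal form of x xor x is false.
open import Tactic.RingSolver.NonReflective (fromCommutativeRing xor-∧-commutativeRing false≟_)
  using (solve; _⊜_; Κ; _⊕_)

∈-∪ˡ : ∀ {x y} → x ≡ true → x ∨ y ≡ true
∈-∪ˡ refl = refl

∈-∪ʳ : ∀ {x y} → y ≡ true → x ∨ y ≡ true
∈-∪ʳ {x} refl = ∨-zeroʳ x

∈-∖ : ∀ {x y} → x ≡ true → y ≡ false → x ∧ not y ≡ true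
∈-∖ refl refl = refl

labelXor : ∀ {m} → VSet m → Bool → Fin m → Fin m → Bool
labelXor h c u v = (h u xor h v) xor c

wholePartition : ∀ {m} → Fin m → VPartition m 1
wholePartition v₀ = record
  { part     = λ _ _ → true
  ; nonempty = λ _ → v₀ , refl
  ; unique   = λ v → zero , refl , λ { zero _ → refl }
  }

labelPart : ∀ {m} → VSet m → Fin 2 → VSet m
labelPart h zero       = h
labelPart h (suc zero) = λ v → not (h v)

labelPartition : ∀ {m} (h : VSet m) → ∃ (λ v → h v ≡ true) → ∃ (λ v → h v ≡ false) →
  VPartition m 2
labelPartition h (v₁ , hv₁) (v₀ , hv₀) = record
  { part     = labelPart h
  ; nonempty = λ { zero → v₁ , hv₁ ; (suc zero) → v₀ , cong not hv₀ }
  ; unique   = λ v → unique-side v (h v) refl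
  }
  where
  false≢true : false ≡ true → ⊥
  false≢true ()

  unique-side : ∀ v b → h v ≡ b →
    Σ (Fin 2) λ i → v ∈ₛ labelPart h i × (∀ j → v ∈ₛ labelPart h j → j ≡ i)
  unique-side v true  hv = zero , hv ,
    λ { zero _ → refl ; (suc zero) ¬hv → ⊥-elim (false≢true (≡.trans (≡.sym (cong not hv)) ¬hv)) }
  unique-side v false hv = suc zero , cong not hv ,
    λ { zero hv′ → ⊥-elim (false≢true (≡.trans (≡.sym hv) hv′)) ; (suc zero) _ → refl }

module _ (G : Graph) where

  Toggles : TwoFlipData G → (Fin (n G) → Fin (n G) → Bool) → Set
  Toggles D t = ∀ u v → twoFlipAdj G D u v ≡ adj G u v xor t u v

  TwoFlipToggling : (Fin (n G) → Fin (n G) → Bool) → Set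
  TwoFlipToggling t = Σ (TwoFlipData G) λ D → Toggles D t

  twoFlip-constant : Fin (n G) → (c : Bool) → TwoFlipToggling (λ _ _ → c)
  twoFlip-constant v₀ true =
    record { k = 1 ; k≤2 = s≤s z≤n ; P = wholePartition v₀ ; S = (zero , zero) ∷ [] ; S-set = [] ∷ [] }
    , λ u v → refl
  twoFlip-constant v₀ false =
    record { k = 1 ; k≤2 = s≤s z≤n ; P = wholePartition v₀ ; S = [] ; S-set = [] }
    , λ u v → ≡.sym (xor-identityʳ (adj G u v))

  twoFlip-split : (h : VSet (n G)) → ∃ (λ v → h v ≡ true) → ∃ (λ v → h v ≡ false) →
    (c : Bool) → TwoFlipToggling (labelXor h c)
  twoFlip-split h h∋true h∋false false =
    record { k = 2 ; k≤2 = s≤s (s≤s z≤n) ; P = labelPartition h h∋true h∋false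
           ; S = (zero , suc zero) ∷ [] ; S-set = [] ∷ [] }
    , λ u v → cong (adj G u v xor_) (across (h u) (h v))
    where
    across : ∀ x y → (x ∧ not y) ∨ (not x ∧ y) ≡ (x xor y) xor false
    across true  true  = refl
    across true  false = refl
    across false true  = refl
    across false false = refl
  twoFlip-split h h∋true h∋false true =
    record { k = 2 ; k≤2 = s≤s (s≤s z≤n) ; P = labelPartition h h∋true h∋false
           ; S = (zero , zero) ∷ (suc zero , suc zero) ∷ [] ; S-set = ((λ ()) ∷ []) ∷ [] ∷ [] }
    , λ u v → ≡.trans (xor-assoc (adj G u v) _ _) (cong (adj G u v xor_) (within (h u) (h v)))
    where
    within : ∀ x y →
      ((not x ∧ not y) ∨ (not x ∧ not y))
        xor ((x ∧ y) ∨ (x ∧ y))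
      ≡ (x xor y) xor true
    within true  true  = refl
    within true  false = refl
    within false true  = refl
    within false false = refl

  twoFlip-constantLabels : Fin (n G) → (h : VSet (n G)) (b : Bool) → (∀ v → h v ≡ b) →
    (c : Bool) → TwoFlipToggling (labelXor h c)
  twoFlip-constantLabels v₀ h b h≡b c with twoFlip-constant v₀ c
  ... | D , toggles =
    D , λ u v → ≡.trans (toggles u v) (cong (adj G u v xor_) (≡.sym (begin
      (h u xor h v) xor c ≡⟨ cong₂ (λ x y → (x xor y) xor c) (h≡b u) (h≡b v) ⟩
      (b xor b) xor c     ≡⟨ cong (_xor c) (xor-same b) ⟩
      c                   ∎)))

  twoFlip-labels : Fin (n G) → (h : VSet (n G)) (c : Bool) → TwoFlipToggling (labelXor h c)
  twoFlip-labels v₀ h c with any? (λ v → h v ≟ true) | any? (λ v → h v ≟ false)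
  ... | yes h∋true | yes h∋false = twoFlip-split h h∋true h∋false c
  ... | no ¬h∋true | _           =
    twoFlip-constantLabels v₀ h false (λ v → ¬-not (λ hv → ¬h∋true (v , hv))) c
  ... | yes _      | no ¬h∋false =
    twoFlip-constantLabels v₀ h true (λ v → ¬-not (λ hv → ¬h∋false (v , hv))) c

  AdjacencyOn : VSet (n G) → VSet (n G) → (Fin (n G) → Fin (n G) → Bool) → Set
  AdjacencyOn X Y t = ∀ u v → u ∈ₛ X → v ∈ₛ Y → adj G u v ≡ t u v

  toggles-noEdgeBetween : ∀ {t X Y} (D : TwoFlipData G) → Toggles D t → AdjacencyOn X Y t →
    NoEdgeBetween (twoFlipAdj G D) X Y
  toggles-noEdgeBetween {t = t} D toggles adjacency u v u∈X v∈Y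
    rewrite toggles u v | adjacency u v u∈X v∈Y = xor-same (t u v)

module BiJoinProperties (G : Graph) (V₁ V₂ : VSet (n G)) (bj : BiJoin G V₁ V₂) where

  V₁-nonempty : Nonempty V₁
  V₁-nonempty = proj₁ (proj₁ bj)

  ∈₂⇒∉₁ : ∀ {v} → v ∈ₛ V₂ → V₁ v ≡ false
  ∈₂⇒∉₁ v∈V₂ = ¬-not (λ v∈V₁ → proj₁ (proj₂ (proj₂ (proj₁ bj))) _ v∈V₁ v∈V₂)

  W₁ W₂ : VSet (n G)
  W₁ = proj₁ (proj₂ bj)
  W₂ = proj₁ (proj₂ (proj₂ bj))

  private
    W-adjacency : Complete G W₁ W₂ × AntiComplete G W₁ (V₂ ∖ₛ W₂) ×
                  Complete G (V₁ ∖ₛ W₁) (V₂ ∖ₛ W₂) × AntiComplete G (V₁ ∖ₛ W₁) W₂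
    W-adjacency = proj₂ (proj₂ (proj₂ (proj₂ (proj₂ bj))))

  adj-across : ∀ {x y} → x ∈ₛ V₁ → y ∈ₛ V₂ → adj G x y ≡ (W₁ x xor W₂ y) xor true
  adj-across {x} {y} x∈ y∈ with W₁ x in x∈W₁ | W₂ y in y∈W₂ | W-adjacency
  ... | true  | true  | W₁-W₂ , _               = W₁-W₂ x y x∈W₁ y∈W₂
  ... | true  | false | _ , W₁-V₂∖W₂ , _       = W₁-V₂∖W₂ x y x∈W₁ (∈-∖ y∈ y∈W₂)
  ... | false | false | _ , _ , V₁∖W₁-V₂∖W₂ , _ = V₁∖W₁-V₂∖W₂ x y (∈-∖ x∈ x∈W₁) (∈-∖ y∈ y∈W₂)
  ... | false | true  | _ , _ , _ , V₁∖W₁-W₂   = V₁∖W₁-W₂ x y (∈-∖ x∈ x∈W₁) y∈W₂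

  adj-square : ∀ {x x′ y y′} → x ∈ₛ V₁ → x′ ∈ₛ V₁ → y ∈ₛ V₂ → y′ ∈ₛ V₂ →
    adj G x y ≡ adj G x y′ xor (adj G x′ y xor adj G x′ y′)
  adj-square {x} {x′} {y} {y′} x∈ x′∈ y∈ y′∈ = begin
    adj G x y                                       ≡⟨ adj-across x∈ y∈ ⟩
    (W₁ x xor W₂ y) xor true                        ≡⟨ xor-square (W₁ x) (W₂ y) (W₂ y′) (W₁ x′) ⟩
    ((W₁ x xor W₂ y′) xor true)
      xor (((W₁ x′ xor W₂ y) xor true) xor ((W₁ x′ xor W₂ y′) xor true))
                                                    ≡⟨ cong₂ _xor_ (≡.sym (adj-across x∈ y′∈))
                                                         (cong₂ _xor_ (≡.sym (adj-across x′∈ y∈))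
                                                                      (≡.sym (adj-across x′∈ y′∈))) ⟩
    adj G x y′ xor (adj G x′ y xor adj G x′ y′)     ∎
    where
    xor-square : ∀ a b b′ a′ →
      (a xor b) xor true ≡ ((a xor b′) xor true) xor (((a′ xor b) xor true) xor ((a′ xor b′) xor true))
    xor-square = solve 4 (λ a b b′ a′ →
      ((a ⊕ b) ⊕ Κ true) ⊜ (((a ⊕ b′) ⊕ Κ true) ⊕ (((a′ ⊕ b) ⊕ Κ true) ⊕ ((a′ ⊕ b′) ⊕ Κ true)))) refl

module TripleLabelling (G : Graph) (A B C : VSet (n G))
  (bjA : BiJoin G A (B ∪ₛ C)) (bjB : BiJoin G B (A ∪ₛ C)) (bjC : BiJoin G C (A ∪ₛ B)) where

  private
    module JoinA = BiJoinProperties G A (B ∪ₛ C) bjA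
    module JoinB = BiJoinProperties G B (A ∪ₛ C) bjB
    module JoinC = BiJoinProperties G C (A ∪ₛ B) bjC

  a₀ b₀ c₀ : Fin (n G)
  a₀ = proj₁ JoinA.V₁-nonempty
  b₀ = proj₁ JoinB.V₁-nonempty
  c₀ = proj₁ JoinC.V₁-nonempty

  a₀∈A : a₀ ∈ₛ A
  a₀∈A = proj₂ JoinA.V₁-nonempty

  b₀∈B : b₀ ∈ₛ B
  b₀∈B = proj₂ JoinB.V₁-nonempty

  c₀∈C : c₀ ∈ₛ C
  c₀∈C = proj₂ JoinC.V₁-nonempty

  parity : Bool
  parity = (adj G c₀ b₀ xor adj G c₀ a₀) xor adj G b₀ a₀

  label : VSet (n G)
  label v = if A v then (adj G v b₀ xor adj G a₀ b₀) xor parity else adj G a₀ v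

  label-∈A : ∀ {v} → v ∈ₛ A → label v ≡ (adj G v b₀ xor adj G a₀ b₀) xor parity
  label-∈A v∈A rewrite v∈A = refl

  label-∉A : ∀ {v} → v ∈ₛ (B ∪ₛ C) → label v ≡ adj G a₀ v
  label-∉A v∉A rewrite JoinA.∈₂⇒∉₁ v∉A = refl

  adjacency-A-BC : AdjacencyOn G A (B ∪ₛ C) (labelXor label parity)
  adjacency-A-BC u v u∈A v∈BC = begin
    adj G u v                                         ≡⟨ JoinA.adj-square u∈A a₀∈A v∈BC (∈-∪ˡ b₀∈B) ⟩
    adj G u b₀ xor (adj G a₀ v xor adj G a₀ b₀)       ≡⟨ regroup (adj G u b₀) (adj G a₀ v) (adj G a₀ b₀) parity ⟩
    (((adj G u b₀ xor adj G a₀ b₀) xor parity) xor adj G a₀ v) xor parity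
                                                      ≡⟨ cong₂ (λ x y → (x xor y) xor parity)
                                                           (≡.sym (label-∈A u∈A)) (≡.sym (label-∉A v∈BC)) ⟩
    labelXor label parity u v                         ∎
    where
    regroup : ∀ p q r c → p xor (q xor r) ≡ (((p xor r) xor c) xor q) xor c
    regroup = solve 4 (λ p q r c → (p ⊕ (q ⊕ r)) ⊜ ((((p ⊕ r) ⊕ c) ⊕ q) ⊕ c)) refl

  adjacency-B-C : AdjacencyOn G B C (labelXor label parity)
  adjacency-B-C u v u∈B v∈C = begin
    adj G u v                                         ≡⟨ JoinB.adj-square u∈B b₀∈B (∈-∪ʳ v∈C) (∈-∪ˡ a₀∈A) ⟩
    adj G u a₀ xor (adj G b₀ v xor adj G b₀ a₀)       ≡⟨ cong₂ (λ x y → x xor (y xor adj G b₀ a₀))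
                                                           (sym G u a₀) (sym G b₀ v) ⟩
    adj G a₀ u xor (adj G v b₀ xor adj G b₀ a₀)       ≡⟨ cong (λ x → adj G a₀ u xor (x xor adj G b₀ a₀))
                                                           (JoinC.adj-square v∈C c₀∈C (∈-∪ʳ b₀∈B) (∈-∪ˡ a₀∈A)) ⟩
    adj G a₀ u xor ((adj G v a₀ xor (adj G c₀ b₀ xor adj G c₀ a₀)) xor adj G b₀ a₀)
                                                      ≡⟨ cong (λ x → adj G a₀ u xor
                                                                  ((x xor (adj G c₀ b₀ xor adj G c₀ a₀)) xor adj G b₀ a₀))
                                                           (sym G v a₀) ⟩
    adj G a₀ u xor ((adj G a₀ v xor (adj G c₀ b₀ xor adj G c₀ a₀)) xor adj G b₀ a₀)
                                                      ≡⟨ regroup (adj G a₀ u) (adj G a₀ v) (adj G c₀ b₀) (adj G c₀ a₀) (adj G b₀ a₀) ⟩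
    (adj G a₀ u xor adj G a₀ v) xor parity            ≡⟨ cong₂ (λ x y → (x xor y) xor parity)
                                                           (≡.sym (label-∉A (∈-∪ˡ u∈B))) (≡.sym (label-∉A (∈-∪ʳ v∈C))) ⟩
    labelXor label parity u v                         ∎
    where
    regroup : ∀ p q r s t → p xor ((q xor (r xor s)) xor t) ≡ (p xor q) xor ((r xor s) xor t)
    regroup = solve 5 (λ p q r s t → (p ⊕ ((q ⊕ (r ⊕ s)) ⊕ t)) ⊜ ((p ⊕ q) ⊕ ((r ⊕ s) ⊕ t))) refl

lemma4p1 : (G : Graph) (A B C : VSet (n G)) → TripleOfBiJoins G A B C →
    Σ (TwoFlipData G) λ D →
      NoEdgeBetween (twoFlipAdj G D) A B ×
      NoEdgeBetween (twoFlipAdj G D) A C ×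
      NoEdgeBetween (twoFlipAdj G D) B C
-- Disjointness of A, B, C already follows from the three bipartitions.
lemma4p1 G A B C (_ , bjA , bjB , bjC) =
  let open TripleLabelling G A B C bjA bjB bjC
      D , toggles = twoFlip-labels G a₀ label parity
  in D , toggles-noEdgeBetween G D toggles (λ u v u∈A v∈B → adjacency-A-BC u v u∈A (∈-∪ˡ v∈B))
       , toggles-noEdgeBetween G D toggles (λ u v u∈A v∈C → adjacency-A-BC u v u∈A (∈-∪ʳ v∈C))
       , toggles-noEdgeBetween G D toggles adjacency-B-C
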